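{- Let $G$ be a connected bipartite $(d_1,d_2)$-semiregular graph $G$. Then there is a group homomorphism $K(\operatorname{line} G) \overset{g}{\rightarrow} K(G)$ whose kernel-cokernel exact sequence $$0 \rightarrow \ker(g) \rightarrow K(\operatorname{line} G) \overset{g}{\rightarrow} K(G) \rightarrow \coker(g) \rightarrow 0$$ has $\coker(g)$ all $\lcm(d_1,d_2)$-torsion, and has $\ker(g)$ all $\frac{d_1+d_2}{\gcd(d_1,d_2)} \lcm(d_1,d_2)$-torsion.
   Context: $K(\cdot)$ denotes the critical group of a graph and $\operatorname{line} G$ the line graph of $G$. A bipartite graph with vertex bipartition $V=V_1\sqcup V_2$ is $(d_1,d_2)$-semiregular if all vertices in $V_i$ have degree $d_i$. -}

module Defs where

open import Data.Bool using (Bool; true; false; if_then_else_; _∧_; _∨_; not)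
open import Data.Nat as ℕ using (ℕ; zero; suc; _<ᵇ_)
open import Data.Fin using (Fin; zero; suc; toℕ; _≟_)
open import Data.Integer as ℤ using (ℤ; +_; 0ℤ; _-_)
open import Data.List using (List; length; lookup; concatMap; map; filterᵇ; allFin)
open import Data.Product using (Σ; ∃; _×_; _,_; proj₁; proj₂)
open import Relation.Nullary using (¬_)
open import Relation.Nullary.Decidable using (⌊_⌋)
open import Relation.Binary.PropositionalEquality using (_≡_)

sumℤ : ∀ {n} → (Fin n → ℤ) → ℤ
sumℤ {zero}  f = 0ℤ
sumℤ {suc n} f = f zero ℤ.+ sumℤ (λ i → f (suc i))

sumℕ : ∀ {n} → (Fin n → ℕ) → ℕ
sumℕ {zero}  f = 0
sumℕ {suc n} f = f zero ℕ.+ sumℕ (λ i → f (suc i))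

Adjacency : ℕ → Set
Adjacency n = Fin n → Fin n → Bool

record SimpleGraph (n : ℕ) : Set where
  field
    adj    : Adjacency n
    sym    : ∀ u v → adj u v ≡ adj v u
    irrefl : ∀ v → adj v v ≡ false
open SimpleGraph public

degree : ∀ {n} → Adjacency n → Fin n → ℕ
degree A v = sumℕ (λ u → if A v u then 1 else 0)

data Reach {n} (A : Adjacency n) : Fin n → Fin n → Set where
  here : ∀ {v} → Reach A v v
  step : ∀ {u w v} → A u w ≡ true → Reach A w v → Reach A u v

Connected : ∀ {n} → SimpleGraph n → Set
Connected G = ∀ u v → Reach (adj G) u v

Semiregular : ∀ {n} → SimpleGraph n → ℕ → ℕ → Set
Semiregular {n} G d1 d2 =
  Σ (Fin n → Bool) λ c →
      (∀ u v → adj G u v ≡ true → ¬ (c u ≡ c v))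
    × (∀ v → c v ≡ false → degree (adj G) v ≡ d1)
    × (∀ v → c v ≡ true  → degree (adj G) v ≡ d2)

-- Line graph: vertices are the edges {i,j} (listed as i < j),
-- two distinct edges adjacent iff they share an endpoint.

edgeList : ∀ {n} → SimpleGraph n → List (Fin n × Fin n)
edgeList {n} G =
  concatMap (λ i → map (λ j → (i , j))
                       (filterᵇ (λ j → (toℕ i <ᵇ toℕ j) ∧ adj G i j) (allFin n)))
            (allFin n)

numEdges : ∀ {n} → SimpleGraph n → ℕ
numEdges G = length (edgeList G)

edge : ∀ {n} (G : SimpleGraph n) → Fin (numEdges G) → Fin n × Fin n
edge G = lookup (edgeList G)

_==_ : ∀ {n} → Fin n → Fin n → Bool
i == j = ⌊ i ≟ j ⌋

lineAdj : ∀ {n} (G : SimpleGraph n) → Adjacency (numEdges G)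
lineAdj G e f with edge G e | edge G f
... | (a , b) | (c , d) =
  not (e == f) ∧ ((a == c) ∨ (a == d) ∨ (b == c) ∨ (b == d))

-- Critical group K = { x ∈ ℤ^V : Σ x = 0 } / im(L), as a setoid.

laplacian : ∀ {n} → Adjacency n → (Fin n → ℤ) → (Fin n → ℤ)
laplacian A z v = sumℤ (λ u → if A v u then z v - z u else 0ℤ)

K : ∀ {n} → Adjacency n → Set
K {n} A = Σ (Fin n → ℤ) λ x → sumℤ x ≡ 0ℤ

_≈K_ : ∀ {n} {A : Adjacency n} → K A → K A → Set
_≈K_ {n} {A} x y =
  ∃ λ (z : Fin n → ℤ) → ∀ v → proj₁ x v - proj₁ y v ≡ laplacian A z v

0K : ∀ {n} {A : Adjacency n} → K A
0K {n} = (λ _ → 0ℤ) , sumℤ0 {n}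
  where
  sumℤ0 : ∀ {m} → sumℤ {m} (λ _ → 0ℤ) ≡ 0ℤ
  sumℤ0 {zero}  = Relation.Binary.PropositionalEquality.refl
  sumℤ0 {suc m} rewrite sumℤ0 {m} = Relation.Binary.PropositionalEquality.refl

-- representatives of sums / multiples; the "sum zero" proof is irrelevant
-- for ≈K, so we only need the underlying vectors, but K needs a proof.
_+V_ : ∀ {n} → (Fin n → ℤ) → (Fin n → ℤ) → (Fin n → ℤ)
(x +V y) v = x v ℤ.+ y v

_·V_ : ∀ {n} → ℕ → (Fin n → ℤ) → (Fin n → ℤ)
(k ·V x) v = (+ k) ℤ.* x v

_≈V_ : ∀ {n} {A : Adjacency n} → (Fin n → ℤ) → (Fin n → ℤ) → Set
_≈V_ {n} {A} x y =
  ∃ λ (z : Fin n → ℤ) → ∀ v → x v - y v ≡ laplacian A z v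

-- A group homomorphism K(A) → K(B) (of the quotient groups), given on
-- representatives: well defined and additive modulo the image of L.
record KHom {n m} (A : Adjacency n) (B : Adjacency m) : Set where
  field
    fun   : K A → K B
    cong  : ∀ x y → _≈K_ {A = A} x y → _≈K_ {A = B} (fun x) (fun y)
    homo  : ∀ x y (s : K A) → proj₁ s ≡ proj₁ x +V proj₁ y →
            _≈V_ {A = B} (proj₁ (fun s)) (proj₁ (fun x) +V proj₁ (fun y))
open KHom public

CokerTorsion : ∀ {n m} {A : Adjacency n} {B : Adjacency m} → KHom A B → ℕ → Set
CokerTorsion {A = A} {B} g k =
  ∀ (y : K B) → ∃ λ (x : K A) → _≈V_ {A = B} (k ·V proj₁ y) (proj₁ (fun g x))

KerTorsion : ∀ {n m} {A : Adjacency n} {B : Adjacency m} → KHom A B → ℕ → Set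
KerTorsion {A = A} {B} g k =
  ∀ (x : K A) → _≈K_ {A = B} (fun g x) (0K {A = B}) → _≈V_ {A = A} (k ·V proj₁ x) (λ _ → 0ℤ)

-- Let B : ℤ^E → ℤ^V be the unsigned incidence map, (B x)(v) = Σ_{e ∋ v} x(e). Then B Bᵀ = D + A, and the
-- Laplacian of line G is L_line = (d(u) + d(v)) I − Bᵀ B at the edge uv. Write each degree as γ ω(v) with
-- γ = gcd(d₁,d₂), and let ω′(v) be the weight of the other colour class, so that ω + ω′ = (d₁+d₂)/γ and
-- γ ω ω′ = lcm(d₁,d₂). The map g x = ω · B x preserves sum-zero vectors and satisfies g ∘ L_line = L_G ∘ (ω′ · B),
-- so it descends to K(line G) → K(G). For an edge uv, L_G(ω′(u) e_u) together with the images g(e_{uv′} − e_{uv})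
-- over the neighbours v′ of u produce lcm · (e_u − e_v); walks in the connected graph G then give lcm times every
-- sum-zero vector, so coker g is lcm-torsion. If g x = L_G z, then L_line(Bᵀ(ω z) + ω ω′ x) equals
-- ((d₁+d₂)/γ) · lcm · x, so ker g is torsion of that order.

module Submission where

open import Data.Bool using (Bool; true; false; T; T?; not; _∧_; _∨_; if_then_else_)
open import Data.Bool.Properties using (T-≡; T-∧)
open import Data.Empty using (⊥; ⊥-elim)
open import Data.Fin using (Fin; zero; suc; toℕ; _≟_)
open import Data.Fin.Properties using (toℕ-injective)
open import Data.Integer using (ℤ; +_; 0ℤ; 1ℤ; -1ℤ)
import Data.Integer as ℤ
import Data.Integer.Properties as ℤP
open import Data.Integer.Tactic.RingSolver using (solve-∀)
open import Data.List using (List; []; _∷_; _++_; map; concatMap; filterᵇ; allFin; tabulate; lookup; foldr)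
open import Data.List.Membership.Propositional using (_∈_)
open import Data.List.Membership.Propositional.Properties
  using (∈-lookup; ∈-allFin; ∈-concatMap⁺; ∈-concatMap⁻; ∈-map∘filter⁺; ∈-map∘filter⁻)
open import Data.List.Relation.Binary.Disjoint.Propositional using (Disjoint)
import Data.List.Relation.Unary.All as All
import Data.List.Relation.Unary.All.Properties as All
open import Data.List.Relation.Unary.AllPairs using (_∷_)
import Data.List.Relation.Unary.AllPairs.Properties as AllPairs
open import Data.List.Relation.Unary.Any as Any using (satisfied; index)
open import Data.List.Relation.Unary.Any.Properties using (lookup-index)
open import Data.List.Relation.Unary.Unique.Propositional using (Unique)
import Data.List.Relation.Unary.Unique.Propositional.Properties as Unique
open import Data.Nat as ℕ using (ℕ; NonZero; _<ᵇ_; _/_)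
open import Data.Nat.Divisibility using (divides)
open import Data.Nat.DivMod using (m*n/n≡m)
open import Data.Nat.GCD using (gcd; gcd[m,n]∣m; gcd[m,n]∣n)
open import Data.Nat.LCM using (lcm; gcd*lcm)
import Data.Nat.Properties as ℕP
open import Data.Nat.Properties using (<ᵇ-reflects-<; <ᵇ⇒<; <⇒<ᵇ; <-cmp; <-asym; <-irrefl; ≤-antisym; ≮⇒≥)
import Data.Nat.Tactic.RingSolver as ℕ-RingSolver
open import Data.Product using (Σ; ∃; _×_; _,_; proj₁; proj₂)
open import Function using (_∘_)
open import Function.Bundles using (Equivalence)
open import Relation.Binary.Definitions using (tri<; tri≈; tri>)
open import Relation.Binary.PropositionalEquality
  using (_≡_; _≢_; _≗_; refl; sym; trans; cong; cong₂; subst; subst₂; module ≡-Reasoning)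
open import Relation.Nullary using (yes; no)
open import Relation.Nullary.Decidable using (⌊⌋-map′; toWitness)
open import Relation.Nullary.Reflects using (ofʸ; ofⁿ)

open import Algebra.Properties.Semiring.Sum ℤP.+-*-semiring
  using (sum; sum-cong-≗; sum-replicate-zero; ∑-distrib-+; ∑-comm; *-distribˡ-sum; *-distribʳ-sum)
open import Algebra.Properties.CommutativeSemigroup ℤP.*-commutativeSemigroup
  using (x∙yz≈y∙xz; xy∙z≈y∙xz)

open import Defs hiding (sym; cong)

module IntegerSums where
  open import Data.Integer using (_+_; _-_; _*_; -_)

  𝟙 : Bool → ℤ
  𝟙 true  = 1ℤ
  𝟙 false = 0ℤ

  if≡𝟙* : ∀ b (a : ℤ) → (if b then a else 0ℤ) ≡ 𝟙 b * a
  if≡𝟙* true  a = sym (ℤP.*-identityˡ a)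
  if≡𝟙* false a = refl

  δ : ∀ {n} → Fin n → Fin n → ℤ
  δ i j = 𝟙 (i == j)

  δ-refl : ∀ {n} (i : Fin n) → δ i i ≡ 1ℤ
  δ-refl i with i ≟ i
  ... | yes _    = refl
  ... | no i≢i   = ⊥-elim (i≢i refl)

  δ-≢ : ∀ {n} {i j : Fin n} → i ≢ j → δ i j ≡ 0ℤ
  δ-≢ {i = i} {j} i≢j with i ≟ j
  ... | yes i≡j = ⊥-elim (i≢j i≡j)
  ... | no _    = refl

  δ-sym : ∀ {n} (i j : Fin n) → δ i j ≡ δ j i
  δ-sym i j with i ≟ j
  ... | yes refl = sym (δ-refl i)
  ... | no i≢j   = sym (δ-≢ (i≢j ∘ sym))

  δ-subst : ∀ {n} (i j : Fin n) (f : Fin n → ℤ) → δ i j * f j ≡ δ i j * f i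
  δ-subst i j f with i ≟ j
  ... | yes refl = refl
  ... | no _     = refl

  sumℤ≡sum : ∀ {n} (f : Fin n → ℤ) → sumℤ f ≡ sum f
  sumℤ≡sum {ℕ.zero}  f = refl
  sumℤ≡sum {ℕ.suc n} f = cong (_+_ (f zero)) (sumℤ≡sum (f ∘ suc))

  sum-neg : ∀ {n} (f : Fin n → ℤ) → sum (λ i → - f i) ≡ - sum f
  sum-neg {ℕ.zero}  f = refl
  sum-neg {ℕ.suc n} f =
    trans (cong (_+_ (- f zero)) (sum-neg (f ∘ suc))) (sym (ℤP.neg-distrib-+ (f zero) _))

  sum-sub : ∀ {n} (f g : Fin n → ℤ) → sum (λ i → f i - g i) ≡ sum f - sum g
  sum-sub f g = trans (∑-distrib-+ f (λ i → - g i)) (cong (_+_ (sum f)) (sum-neg g))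

  sum-δ : ∀ {n} (i : Fin n) (f : Fin n → ℤ) → sum (λ j → δ i j * f j) ≡ f i
  sum-δ {ℕ.suc n} zero f =
    trans (cong₂ _+_ (ℤP.*-identityˡ (f zero)) (sum-replicate-zero n)) (ℤP.+-identityʳ (f zero))
  sum-δ (suc i) f = begin
    0ℤ + sum (λ j → δ (suc i) (suc j) * f (suc j)) ≡⟨ ℤP.+-identityˡ _ ⟩
    sum (λ j → δ (suc i) (suc j) * f (suc j))      ≡⟨ sum-cong-≗ (λ j → cong (λ b → 𝟙 b * f (suc j)) (==-suc j)) ⟩
    sum (λ j → δ i j * f (suc j))                  ≡⟨ sum-δ i (f ∘ suc) ⟩
    f (suc i)                                      ∎
    where
    open ≡-Reasoning
    ==-suc : ∀ j → (suc i == suc j) ≡ (i == j)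
    ==-suc j = ⌊⌋-map′ _ _ (i ≟ j)

  sum-δ-one : ∀ {n} (i : Fin n) → sum (δ i) ≡ 1ℤ
  sum-δ-one i = trans (sum-cong-≗ (λ j → sym (ℤP.*-identityʳ (δ i j)))) (sum-δ i (λ _ → 1ℤ))

  sum-δ′ : ∀ {n} (i : Fin n) (f : Fin n → ℤ) → sum (λ j → δ j i * f j) ≡ f i
  sum-δ′ i f = trans (sum-cong-≗ (λ j → cong (_* f j) (δ-sym j i))) (sum-δ i f)

  Exclusive : Bool → Bool → Set
  Exclusive a b = T a → T b → ⊥

  𝟙-∨-pairwise-exclusive : ∀ a b c d →
    Exclusive a b → Exclusive a c → Exclusive a d → Exclusive b c → Exclusive b d → Exclusive c d →
    (𝟙 a + 𝟙 b) + (𝟙 c + 𝟙 d) ≡ 𝟙 (a ∨ b ∨ c ∨ d)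
  𝟙-∨-pairwise-exclusive true  true  _     _     ab _  _  _  _  _  = ⊥-elim (ab _ _)
  𝟙-∨-pairwise-exclusive true  false true  _     _  ac _  _  _  _  = ⊥-elim (ac _ _)
  𝟙-∨-pairwise-exclusive true  false false true  _  _  ad _  _  _  = ⊥-elim (ad _ _)
  𝟙-∨-pairwise-exclusive true  false false false _  _  _  _  _  _  = refl
  𝟙-∨-pairwise-exclusive false true  true  _     _  _  _  bc _  _  = ⊥-elim (bc _ _)
  𝟙-∨-pairwise-exclusive false true  false true  _  _  _  _  bd _  = ⊥-elim (bd _ _)
  𝟙-∨-pairwise-exclusive false true  false false _  _  _  _  _  _  = refl
  𝟙-∨-pairwise-exclusive false false true  true  _  _  _  _  _  cd = ⊥-elim (cd _ _)
  𝟙-∨-pairwise-exclusive false false true  false _  _  _  _  _  _  = refl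
  𝟙-∨-pairwise-exclusive false false false true  _  _  _  _  _  _  = refl
  𝟙-∨-pairwise-exclusive false false false false _  _  _  _  _  _  = refl

  listSum : ∀ {a} {X : Set a} → (X → ℤ) → List X → ℤ
  listSum H = foldr (λ x s → H x + s) 0ℤ

  module _ {a} {X : Set a} (H : X → ℤ) where

    sum-lookup : ∀ xs → sum (H ∘ lookup xs) ≡ listSum H xs
    sum-lookup []       = refl
    sum-lookup (x ∷ xs) = cong (_+_ (H x)) (sum-lookup xs)

    listSum-++ : ∀ xs ys → listSum H (xs ++ ys) ≡ listSum H xs + listSum H ys
    listSum-++ []       ys = sym (ℤP.+-identityˡ (listSum H ys))
    listSum-++ (x ∷ xs) ys =
      trans (cong (_+_ (H x)) (listSum-++ xs ys)) (sym (ℤP.+-assoc (H x) (listSum H xs) (listSum H ys)))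

    listSum-filterᵇ : ∀ p xs → listSum H (filterᵇ p xs) ≡ listSum (λ x → 𝟙 (p x) * H x) xs
    listSum-filterᵇ p []       = refl
    listSum-filterᵇ p (x ∷ xs) with p x
    ... | true  = cong₂ _+_ (sym (ℤP.*-identityˡ (H x))) (listSum-filterᵇ p xs)
    ... | false = trans (listSum-filterᵇ p xs) (sym (ℤP.+-identityˡ _))

    listSum-tabulate : ∀ {r} (t : Fin r → X) → listSum H (tabulate t) ≡ sum (H ∘ t)
    listSum-tabulate {ℕ.zero}  t = refl
    listSum-tabulate {ℕ.suc r} t = cong (_+_ (H (t zero))) (listSum-tabulate (t ∘ suc))

  listSum-map : ∀ {a b} {X : Set a} {Y : Set b} (H : Y → ℤ) (k : X → Y) xs →
                listSum H (map k xs) ≡ listSum (H ∘ k) xs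
  listSum-map H k []       = refl
  listSum-map H k (x ∷ xs) = cong (_+_ (H (k x))) (listSum-map H k xs)

  listSum-concatMap : ∀ {a b} {X : Set a} {Y : Set b} (H : Y → ℤ) (k : X → List Y) xs →
                      listSum H (concatMap k xs) ≡ listSum (listSum H ∘ k) xs
  listSum-concatMap H k []       = refl
  listSum-concatMap H k (x ∷ xs) =
    trans (listSum-++ H (k x) (concatMap k xs)) (cong (_+_ (listSum H (k x))) (listSum-concatMap H k xs))

module LinearMaps where
  open import Data.Integer using (_+_; _-_; _*_; -_)
  open IntegerSums

  act : ∀ {m n} → (Fin n → Fin m → ℤ) → (Fin m → ℤ) → Fin n → ℤ
  act M x i = sum (λ j → M i j * x j)

  record IsLinear {m n} (F : (Fin m → ℤ) → Fin n → ℤ) : Set where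
    field
      ≗-cong : ∀ {x y} → x ≗ y → F x ≗ F y
      +-hom  : ∀ x y → F (λ j → x j + y j) ≗ λ i → F x i + F y i
      *-hom  : ∀ k x → F (λ j → k * x j) ≗ λ i → k * F x i

    zero-hom : F (λ _ → 0ℤ) ≗ λ _ → 0ℤ
    zero-hom = *-hom 0ℤ (λ _ → 0ℤ)

    sub-hom : ∀ x y → F (λ j → x j - y j) ≗ λ i → F x i - F y i
    sub-hom x y i = trans (+-hom x (λ j → - y j) i) (cong (_+_ (F x i)) neg-hom)
      where
      neg-hom : F (λ j → - y j) i ≡ - F y i
      neg-hom = begin
        F (λ j → - y j) i      ≡⟨ ≗-cong (λ j → sym (ℤP.-1*i≡-i (y j))) i ⟩
        F (λ j → -1ℤ * y j) i  ≡⟨ *-hom -1ℤ y i ⟩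
        -1ℤ * F y i            ≡⟨ ℤP.-1*i≡-i (F y i) ⟩
        - F y i                ∎
        where open ≡-Reasoning

  act-linear : ∀ {m n} (M : Fin n → Fin m → ℤ) → IsLinear (act M)
  act-linear M = record
    { ≗-cong = λ x≗y i → sum-cong-≗ (λ j → cong (M i j *_) (x≗y j))
    ; +-hom  = λ x y i → trans (sum-cong-≗ (λ j → ℤP.*-distribˡ-+ (M i j) (x j) (y j)))
                               (∑-distrib-+ (λ j → M i j * x j) (λ j → M i j * y j))
    ; *-hom  = λ k x i → trans (sum-cong-≗ (λ j → x∙yz≈y∙xz (M i j) k (x j)))
                               (sym (*-distribˡ-sum k (λ j → M i j * x j)))
    }

  scale-linear : ∀ {m n} {F : (Fin m → ℤ) → Fin n → ℤ} (c : Fin n → ℤ) →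
                 IsLinear F → IsLinear (λ x i → c i * F x i)
  scale-linear c lin = record
    { ≗-cong = λ x≗y i → cong (c i *_) (≗-cong x≗y i)
    ; +-hom  = λ x y i → trans (cong (c i *_) (+-hom x y i)) (ℤP.*-distribˡ-+ (c i) _ _)
    ; *-hom  = λ k x i → trans (cong (c i *_) (*-hom k x i)) (x∙yz≈y∙xz (c i) k _)
    }
    where open IsLinear lin

module Laplacians where
  open import Data.Integer using (_+_; _-_; _*_; -_)
  open IntegerSums
  open LinearMaps

  deg : ∀ {n} → Adjacency n → Fin n → ℤ
  deg A v = sum (λ u → 𝟙 (A v u))

  neighbourSum : ∀ {n} → Adjacency n → (Fin n → ℤ) → Fin n → ℤ
  neighbourSum A = act (λ v u → 𝟙 (A v u))

  degree≡deg : ∀ {n} (A : Adjacency n) v → + degree A v ≡ deg A v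
  degree≡deg A v = trans (+sumℕ (λ u → if A v u then 1 else 0)) (sum-cong-≗ (λ u → +if (A v u)))
    where
    +sumℕ : ∀ {n} (h : Fin n → ℕ) → + sumℕ h ≡ sum (λ i → + h i)
    +sumℕ {ℕ.zero}  h = refl
    +sumℕ {ℕ.suc n} h = trans (ℤP.pos-+ (h zero) _) (cong (_+_ (+ h zero)) (+sumℕ (h ∘ suc)))
    +if : ∀ b → + (if b then 1 else 0) ≡ 𝟙 b
    +if true  = refl
    +if false = refl

  laplacian-sum : ∀ {n} (A : Adjacency n) z v →
                  laplacian A z v ≡ sum (λ u → 𝟙 (A v u) * (z v - z u))
  laplacian-sum A z v =
    trans (sumℤ≡sum (λ u → if A v u then z v - z u else 0ℤ)) (sum-cong-≗ (λ u → if≡𝟙* (A v u) (z v - z u)))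

  laplacian-expand : ∀ {n} (A : Adjacency n) z v →
                     laplacian A z v ≡ deg A v * z v - neighbourSum A z v
  laplacian-expand A z v = begin
    laplacian A z v
      ≡⟨ laplacian-sum A z v ⟩
    sum (λ u → 𝟙 (A v u) * (z v - z u))
      ≡⟨ sum-cong-≗ (λ u → distrib (𝟙 (A v u)) (z v) (z u)) ⟩
    sum (λ u → 𝟙 (A v u) * z v - 𝟙 (A v u) * z u)
      ≡⟨ sum-sub (λ u → 𝟙 (A v u) * z v) (λ u → 𝟙 (A v u) * z u) ⟩
    sum (λ u → 𝟙 (A v u) * z v) - neighbourSum A z v
      ≡⟨ cong (_- neighbourSum A z v) (sym (*-distribʳ-sum (z v) (λ u → 𝟙 (A v u)))) ⟩
    deg A v * z v - neighbourSum A z v ∎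
    where
    open ≡-Reasoning
    distrib : ∀ e a b → e * (a - b) ≡ e * a - e * b
    distrib = solve-∀

  laplacian-linear : ∀ {n} (A : Adjacency n) → IsLinear (laplacian A)
  laplacian-linear A = record
    { ≗-cong = λ {x} {y} x≗y v → begin
        laplacian A x v
          ≡⟨ laplacian-sum A x v ⟩
        sum (λ u → 𝟙 (A v u) * (x v - x u))
          ≡⟨ sum-cong-≗ (λ u → cong₂ (λ a b → 𝟙 (A v u) * (a - b)) (x≗y v) (x≗y u)) ⟩
        sum (λ u → 𝟙 (A v u) * (y v - y u))
          ≡⟨ sym (laplacian-sum A y v) ⟩
        laplacian A y v ∎
    ; +-hom = λ x y v → begin
        laplacian A (λ j → x j + y j) v
          ≡⟨ laplacian-sum A (λ j → x j + y j) v ⟩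
        sum (λ u → 𝟙 (A v u) * ((x v + y v) - (x u + y u)))
          ≡⟨ sum-cong-≗ (λ u → split (𝟙 (A v u)) (x v) (y v) (x u) (y u)) ⟩
        sum (λ u → 𝟙 (A v u) * (x v - x u) + 𝟙 (A v u) * (y v - y u))
          ≡⟨ ∑-distrib-+ (λ u → 𝟙 (A v u) * (x v - x u)) (λ u → 𝟙 (A v u) * (y v - y u)) ⟩
        sum (λ u → 𝟙 (A v u) * (x v - x u)) + sum (λ u → 𝟙 (A v u) * (y v - y u))
          ≡⟨ sym (cong₂ _+_ (laplacian-sum A x v) (laplacian-sum A y v)) ⟩
        laplacian A x v + laplacian A y v ∎
    ; *-hom = λ k x v → begin
        laplacian A (λ j → k * x j) v
          ≡⟨ laplacian-sum A (λ j → k * x j) v ⟩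
        sum (λ u → 𝟙 (A v u) * (k * x v - k * x u))
          ≡⟨ sum-cong-≗ (λ u → factor (𝟙 (A v u)) k (x v) (x u)) ⟩
        sum (λ u → k * (𝟙 (A v u) * (x v - x u)))
          ≡⟨ sym (*-distribˡ-sum k (λ u → 𝟙 (A v u) * (x v - x u))) ⟩
        k * sum (λ u → 𝟙 (A v u) * (x v - x u))
          ≡⟨ sym (cong (k *_) (laplacian-sum A x v)) ⟩
        k * laplacian A x v ∎
    }
    where
    open ≡-Reasoning
    split : ∀ e a b c d → e * ((a + b) - (c + d)) ≡ e * (a - c) + e * (b - d)
    split = solve-∀
    factor : ∀ e k a b → e * (k * a - k * b) ≡ k * (e * (a - b))
    factor = solve-∀

  neighbourSum-factor : ∀ {n} (A : Adjacency n) (c z : Fin n → ℤ) {k v} →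
    (∀ u → A v u ≡ true → c u ≡ k) → neighbourSum A (λ u → c u * z u) v ≡ k * neighbourSum A z v
  neighbourSum-factor A c z {k} {v} c≡k =
    trans (sum-cong-≗ pull-out) (sym (*-distribˡ-sum k (λ u → 𝟙 (A v u) * z u)))
    where
    pull-out : ∀ u → 𝟙 (A v u) * (c u * z u) ≡ k * (𝟙 (A v u) * z u)
    pull-out u with A v u in v~u
    ... | true  = trans (ℤP.*-identityˡ (c u * z u))
                        (trans (cong (_* z u) (c≡k u v~u)) (cong (k *_) (sym (ℤP.*-identityˡ (z u)))))
    ... | false = sym (ℤP.*-zeroʳ k)

  laplacian-δ : ∀ {n} (A : Adjacency n) u i → laplacian A (δ u) i ≡ δ u i * deg A u - 𝟙 (A i u)
  laplacian-δ A u i = begin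
    laplacian A (δ u) i
      ≡⟨ laplacian-expand A (δ u) i ⟩
    deg A i * δ u i - neighbourSum A (δ u) i
      ≡⟨ cong₂ _-_ (trans (ℤP.*-comm (deg A i) (δ u i)) (δ-subst u i (deg A)))
                   (trans (sum-cong-≗ (λ t → ℤP.*-comm (𝟙 (A i t)) (δ u t))) (sum-δ u (λ t → 𝟙 (A i t)))) ⟩
    δ u i * deg A u - 𝟙 (A i u) ∎
    where open ≡-Reasoning

  sum-neighbour-differences : ∀ {n} (A : Adjacency n) u v i →
    sum (λ v′ → 𝟙 (A u v′) * (δ v′ i - δ v i)) ≡ 𝟙 (A u i) - δ v i * deg A u
  sum-neighbour-differences A u v i = begin
    sum (λ v′ → 𝟙 (A u v′) * (δ v′ i - δ v i))
      ≡⟨ sum-cong-≗ (λ v′ → trans (distrib (𝟙 (A u v′)) (δ v′ i) (δ v i))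
                                  (cong (λ d → d * 𝟙 (A u v′) - δ v i * 𝟙 (A u v′)) (δ-sym v′ i))) ⟩
    sum (λ v′ → δ i v′ * 𝟙 (A u v′) - δ v i * 𝟙 (A u v′))
      ≡⟨ sum-sub (λ v′ → δ i v′ * 𝟙 (A u v′)) (λ v′ → δ v i * 𝟙 (A u v′)) ⟩
    sum (λ v′ → δ i v′ * 𝟙 (A u v′)) - sum (λ v′ → δ v i * 𝟙 (A u v′))
      ≡⟨ cong₂ _-_ (sum-δ i (λ v′ → 𝟙 (A u v′))) (sym (*-distribˡ-sum (δ v i) (λ v′ → 𝟙 (A u v′)))) ⟩
    𝟙 (A u i) - δ v i * deg A u ∎
    where
    open ≡-Reasoning
    distrib : ∀ e a b → e * (a - b) ≡ a * e - b * e
    distrib = solve-∀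

  record IsSubmodule {n} (P : (Fin n → ℤ) → Set) : Set where
    field
      zero-closed : P (λ _ → 0ℤ)
      +-closed    : ∀ {x y} → P x → P y → P (λ i → x i + y i)
      *-closed    : ∀ k {x} → P x → P (λ i → k * x i)
      ≗-closed    : ∀ {x y} → x ≗ y → P x → P y

    sum-closed : ∀ {r} (V : Fin r → Fin n → ℤ) → (∀ j → P (V j)) → P (λ i → sum (λ j → V j i))
    sum-closed {ℕ.zero}  V PV = zero-closed
    sum-closed {ℕ.suc r} V PV = +-closed (PV zero) (sum-closed (V ∘ suc) (PV ∘ suc))

  -- Write c·y as the combination Σⱼ yⱼ · c(eⱼ - e₀) of differences along walks to the vertex 0.
  connected-spans-sum-zero :
    ∀ {n} (G : SimpleGraph n) → Connected G → ∀ {P} → IsSubmodule P → (c : ℤ) →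
    (∀ u v → adj G u v ≡ true → P (λ i → c * (δ u i - δ v i))) →
    ∀ y → sum y ≡ 0ℤ → P (λ i → c * y i)
  connected-spans-sum-zero {ℕ.zero}  G conn P-sub c edge y Σy≡0 = ≗-closed (λ ()) zero-closed
    where open IsSubmodule P-sub
  connected-spans-sum-zero {ℕ.suc n} G conn {P} P-sub c edge y Σy≡0 =
    ≗-closed combination (sum-closed (λ j i → y j * (c * (δ j i - δ zero i)))
                                      (λ j → *-closed (y j) (walk (conn j zero))))
    where
    open IsSubmodule P-sub
    open ≡-Reasoning

    walk : ∀ {u v} → Reach (adj G) u v → P (λ i → c * (δ u i - δ v i))
    walk {u} here = ≗-closed (λ i → sym (vanish c (δ u i))) zero-closed
      where
      vanish : ∀ c a → c * (a - a) ≡ 0ℤ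
      vanish = solve-∀
    walk {u} (step {w = w} {v} u~w w⇝v) =
      ≗-closed (λ i → telescope c (δ u i) (δ w i) (δ v i)) (+-closed (edge u w u~w) (walk w⇝v))
      where
      telescope : ∀ c a b d → c * (a - b) + c * (b - d) ≡ c * (a - d)
      telescope = solve-∀

    combination : (λ i → sum (λ j → y j * (c * (δ j i - δ zero i)))) ≗ (λ i → c * y i)
    combination i = begin
      sum (λ j → y j * (c * (δ j i - δ zero i)))
        ≡⟨ sum-cong-≗ (λ j → trans (expand (y j) c (δ j i) (δ zero i))
                                   (cong (λ d → c * (d * y j) - (c * δ zero i) * y j) (δ-sym j i))) ⟩
      sum (λ j → c * (δ i j * y j) - (c * δ zero i) * y j)
        ≡⟨ sum-sub (λ j → c * (δ i j * y j)) (λ j → (c * δ zero i) * y j) ⟩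
      sum (λ j → c * (δ i j * y j)) - sum (λ j → (c * δ zero i) * y j)
        ≡⟨ cong₂ _-_ (sym (*-distribˡ-sum c (λ j → δ i j * y j))) (sym (*-distribˡ-sum (c * δ zero i) y)) ⟩
      c * sum (λ j → δ i j * y j) - (c * δ zero i) * sum y
        ≡⟨ cong₂ (λ a b → c * a - (c * δ zero i) * b) (sum-δ i y) Σy≡0 ⟩
      c * y i - (c * δ zero i) * 0ℤ
        ≡⟨ drop (c * y i) (c * δ zero i) ⟩
      c * y i ∎
      where
      expand : ∀ y c a b → y * (c * (a - b)) ≡ c * (a * y) - (c * b) * y
      expand = solve-∀
      drop : ∀ a b → a - b * 0ℤ ≡ a
      drop = solve-∀

  module Induced {m n} {A : Adjacency m} {B : Adjacency n}
                 (F : (Fin m → ℤ) → Fin n → ℤ) (F-linear : IsLinear F)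
                 (F-sum-zero : ∀ x → sum x ≡ 0ℤ → sum (F x) ≡ 0ℤ)
                 (H : (Fin m → ℤ) → Fin n → ℤ)
                 (intertwines : ∀ y → F (laplacian A y) ≗ laplacian B (H y)) where
    open IsLinear F-linear
    open IsLinear (laplacian-linear B) using () renaming (zero-hom to laplacian-zero)

    inducedHom : KHom A B
    inducedHom = record
      { fun  = λ x → F (proj₁ x) , sum-zero-preserved x
      ; cong = λ x y (z , x-y≡Lz) → H z , λ v →
          trans (sym (sub-hom (proj₁ x) (proj₁ y) v)) (trans (≗-cong x-y≡Lz v) (intertwines z v))
      ; homo = λ x y s s≡x+y → (λ _ → 0ℤ) , λ v → begin
          F (proj₁ s) v - (F (proj₁ x) v + F (proj₁ y) v)
            ≡⟨ cong (_- (F (proj₁ x) v + F (proj₁ y) v))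
                    (trans (≗-cong (λ j → cong (λ h → h j) s≡x+y) v) (+-hom (proj₁ x) (proj₁ y) v)) ⟩
          (F (proj₁ x) v + F (proj₁ y) v) - (F (proj₁ x) v + F (proj₁ y) v)
            ≡⟨ ℤP.+-inverseʳ (F (proj₁ x) v + F (proj₁ y) v) ⟩
          0ℤ
            ≡⟨ sym (laplacian-zero v) ⟩
          laplacian B (λ _ → 0ℤ) v ∎
      }
      where
      open ≡-Reasoning
      sum-zero-preserved : (x : K A) → sumℤ (F (proj₁ x)) ≡ 0ℤ
      sum-zero-preserved (x , Σx≡0) =
        trans (sumℤ≡sum (F x)) (F-sum-zero x (trans (sym (sumℤ≡sum x)) Σx≡0))

    InImage : (Fin n → ℤ) → Set
    InImage v = Σ (Fin m → ℤ) λ x → sum x ≡ 0ℤ × ∃ λ z → v ≗ λ i → F x i + laplacian B z i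

    inImage-submodule : IsSubmodule InImage
    inImage-submodule = record
      { zero-closed = (λ _ → 0ℤ) , sum-replicate-zero m , (λ _ → 0ℤ) , λ i →
          sym (trans (cong₂ _+_ (zero-hom i) (laplacian-zero i)) (ℤP.+-identityˡ 0ℤ))
      ; +-closed = λ (x , Σx , z , e) (x′ , Σx′ , z′ , e′) →
          (λ j → x j + x′ j) , trans (∑-distrib-+ x x′) (cong₂ _+_ Σx Σx′) ,
          (λ j → z j + z′ j) , λ i → trans (cong₂ _+_ (e i) (e′ i))
            (trans (interchange (F x i) (laplacian B z i) (F x′ i) (laplacian B z′ i))
                   (sym (cong₂ _+_ (+-hom x x′ i) (laplacian-+ z z′ i))))
      ; *-closed = λ k (x , Σx , z , e) →
          (λ j → k * x j) , trans (sym (*-distribˡ-sum k x)) (trans (cong (k *_) Σx) (ℤP.*-zeroʳ k)) ,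
          (λ j → k * z j) , λ i → trans (cong (k *_) (e i))
            (trans (ℤP.*-distribˡ-+ k (F x i) (laplacian B z i))
                   (sym (cong₂ _+_ (*-hom k x i) (laplacian-* k z i))))
      ; ≗-closed = λ v≗w (x , Σx , z , e) → x , Σx , z , λ i → trans (sym (v≗w i)) (e i)
      }
      where
      open IsLinear (laplacian-linear B) using () renaming (+-hom to laplacian-+; *-hom to laplacian-*)
      interchange : ∀ a b c d → (a + b) + (c + d) ≡ (a + c) + (b + d)
      interchange = solve-∀

    laplacian-inImage : ∀ z → InImage (laplacian B z)
    laplacian-inImage z = (λ _ → 0ℤ) , sum-replicate-zero m , z , λ i →
      sym (trans (cong (_+ laplacian B z i) (zero-hom i)) (ℤP.+-identityˡ (laplacian B z i)))

    inImage⇒cokerTorsion : ∀ k → (∀ y → sum y ≡ 0ℤ → InImage (λ i → + k * y i)) → CokerTorsion inducedHom k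
    inImage⇒cokerTorsion k reach (y , Σy≡0) with reach y (trans (sym (sumℤ≡sum y)) Σy≡0)
    ... | x , Σx≡0 , z , ky≡Fx+Lz =
      (x , trans (sumℤ≡sum x) Σx≡0) , z , λ i → trans (cong (_- F x i) (ky≡Fx+Lz i)) (cancel (F x i) _)
      where
      cancel : ∀ a b → (a + b) - a ≡ b
      cancel = solve-∀

lookup-injective : ∀ {a} {X : Set a} {xs : List X} → Unique xs →
                   ∀ {i j} → lookup xs i ≡ lookup xs j → i ≡ j
lookup-injective (_ ∷ _) {zero} {zero} _ = refl
lookup-injective {xs = _ ∷ xs} (x∉xs ∷ _) {zero} {suc j} x≡xsⱼ =
  ⊥-elim (All.lookup x∉xs (∈-lookup {xs = xs} j) x≡xsⱼ)
lookup-injective {xs = _ ∷ xs} (x∉xs ∷ _) {suc i} {zero} xsᵢ≡x =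
  ⊥-elim (All.lookup x∉xs (∈-lookup {xs = xs} i) (sym xsᵢ≡x))
lookup-injective (_ ∷ xs-unique) {suc i} {suc j} xsᵢ≡xsⱼ =
  cong suc (lookup-injective xs-unique xsᵢ≡xsⱼ)

module EdgeList {n} (G : SimpleGraph n) where
  open import Data.Integer using (_+_; _-_; _*_)
  open IntegerSums

  lo hi : Fin (numEdges G) → Fin n
  lo f = proj₁ (edge G f)
  hi f = proj₂ (edge G f)

  ordered : Fin n → Fin n → Bool
  ordered i j = (toℕ i <ᵇ toℕ j) ∧ adj G i j

  row : Fin n → List (Fin n × Fin n)
  row i = map (i ,_) (filterᵇ (ordered i) (allFin n))

  sum-edges : ∀ (F : Fin n → Fin n → ℤ) →
              sum (λ f → F (lo f) (hi f)) ≡ sum (λ i → sum (λ j → 𝟙 (ordered i j) * F i j))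
  sum-edges F = begin
    sum (λ f → F (lo f) (hi f))                        ≡⟨ sum-lookup F′ (edgeList G) ⟩
    listSum F′ (concatMap row (allFin n))              ≡⟨ listSum-concatMap F′ row (allFin n) ⟩
    listSum (listSum F′ ∘ row) (allFin n)              ≡⟨ listSum-tabulate (listSum F′ ∘ row) (λ i → i) ⟩
    sum (λ i → listSum F′ (row i))                     ≡⟨ sum-cong-≗ row-sum ⟩
    sum (λ i → sum (λ j → 𝟙 (ordered i j) * F i j))    ∎
    where
    open ≡-Reasoning
    F′ : Fin n × Fin n → ℤ
    F′ (i , j) = F i j
    row-sum : ∀ i → listSum F′ (row i) ≡ sum (λ j → 𝟙 (ordered i j) * F i j)
    row-sum i = trans (listSum-map F′ (i ,_) (filterᵇ (ordered i) (allFin n)))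
                (trans (listSum-filterᵇ (F i) (ordered i) (allFin n))
                       (listSum-tabulate (λ j → 𝟙 (ordered i j) * F i j) (λ j → j)))

  ordered-complementary : ∀ i j → 𝟙 (ordered i j) + 𝟙 (ordered j i) ≡ 𝟙 (adj G i j)
  ordered-complementary i j
    with toℕ i <ᵇ toℕ j | <ᵇ-reflects-< (toℕ i) (toℕ j) | toℕ j <ᵇ toℕ i | <ᵇ-reflects-< (toℕ j) (toℕ i)
  ... | true  | ofʸ i<j | true  | ofʸ j<i = ⊥-elim (<-asym i<j j<i)
  ... | true  | _       | false | _       = ℤP.+-identityʳ (𝟙 (adj G i j))
  ... | false | _       | true  | _       = trans (ℤP.+-identityˡ _) (cong 𝟙 (SimpleGraph.sym G j i))
  ... | false | ofⁿ i≮j | false | ofⁿ j≮i =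
    subst (λ k → 0ℤ ≡ 𝟙 (adj G i k)) (toℕ-injective (≤-antisym (≮⇒≥ j≮i) (≮⇒≥ i≮j)))
          (cong 𝟙 (sym (irrefl G i)))

  sum-edges-sym : ∀ (F : Fin n → Fin n → ℤ) →
    sum (λ f → F (lo f) (hi f) + F (hi f) (lo f)) ≡ sum (λ i → sum (λ j → 𝟙 (adj G i j) * F i j))
  sum-edges-sym F = begin
    sum (λ f → F (lo f) (hi f) + F (hi f) (lo f))
      ≡⟨ ∑-distrib-+ (λ f → F (lo f) (hi f)) (λ f → F (hi f) (lo f)) ⟩
    sum (λ f → F (lo f) (hi f)) + sum (λ f → F (hi f) (lo f))
      ≡⟨ cong₂ _+_ (sum-edges F)
                   (trans (sum-edges (λ i j → F j i)) (∑-comm (λ i j → 𝟙 (ordered i j) * F j i))) ⟩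
    sum (λ i → ∑ᵢ i) + sum (λ i → ∑ⱼ i)
      ≡⟨ sym (∑-distrib-+ ∑ᵢ ∑ⱼ) ⟩
    sum (λ i → ∑ᵢ i + ∑ⱼ i)
      ≡⟨ sum-cong-≗ (λ i → sym (∑-distrib-+ (λ j → 𝟙 (ordered i j) * F i j) (λ j → 𝟙 (ordered j i) * F i j))) ⟩
    sum (λ i → sum (λ j → 𝟙 (ordered i j) * F i j + 𝟙 (ordered j i) * F i j))
      ≡⟨ sum-cong-≗ (λ i → sum-cong-≗ (λ j → combine i j)) ⟩
    sum (λ i → sum (λ j → 𝟙 (adj G i j) * F i j)) ∎
    where
    open ≡-Reasoning
    ∑ᵢ ∑ⱼ : Fin n → ℤ
    ∑ᵢ i = sum (λ j → 𝟙 (ordered i j) * F i j)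
    ∑ⱼ i = sum (λ j → 𝟙 (ordered j i) * F i j)
    combine : ∀ i j → 𝟙 (ordered i j) * F i j + 𝟙 (ordered j i) * F i j ≡ 𝟙 (adj G i j) * F i j
    combine i j = trans (sym (ℤP.*-distribʳ-+ (F i j) (𝟙 (ordered i j)) (𝟙 (ordered j i))))
                        (cong (_* F i j) (ordered-complementary i j))

  edge-ordered : ∀ f → T (ordered (lo f) (hi f))
  edge-ordered f with satisfied (∈-concatMap⁻ row {xs = allFin n} (∈-lookup f))
  ... | i , f∈row with ∈-map∘filter⁻ (i ,_) (T? ∘ ordered i) {xs = allFin n} f∈row
  ...   | j , _ , edge≡ij , ordered-ij = subst (λ e → T (ordered (proj₁ e) (proj₂ e))) (sym edge≡ij) ordered-ij

  edge-adj : ∀ f → adj G (lo f) (hi f) ≡ true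
  edge-adj f = Equivalence.to T-≡ (proj₂ (Equivalence.to T-∧ (edge-ordered f)))

  lo<hi : ∀ f → toℕ (lo f) ℕ.< toℕ (hi f)
  lo<hi f = <ᵇ⇒< _ _ (proj₁ (Equivalence.to T-∧ (edge-ordered f)))

  lo≢hi : ∀ f → lo f ≢ hi f
  lo≢hi f lo≡hi = <-irrefl (cong toℕ lo≡hi) (lo<hi f)

  ordered-intro : ∀ {u v} → toℕ u ℕ.< toℕ v → adj G u v ≡ true → T (ordered u v)
  ordered-intro u<v u~v = Equivalence.from T-∧ (<⇒<ᵇ u<v , Equivalence.from T-≡ u~v)

  edge-exists : ∀ {u v} → T (ordered u v) → ∃ λ f → lo f ≡ u × hi f ≡ v
  edge-exists {u} {v} ordered-uv =
    index uv∈edges , cong proj₁ (sym (lookup-index uv∈edges)) , cong proj₂ (sym (lookup-index uv∈edges))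
    where
    uv∈row : (u , v) ∈ row u
    uv∈row = ∈-map∘filter⁺ (u ,_) (T? ∘ ordered u) (v , ∈-allFin v , refl , ordered-uv)
    uv∈edges : (u , v) ∈ edgeList G
    uv∈edges = ∈-concatMap⁺ row (Any.map (λ { refl → uv∈row }) (∈-allFin u))

  edgeList-unique : Unique (edgeList G)
  edgeList-unique =
    Unique.concat⁺ (All.map⁺ (All.tabulate⁺ row-unique)) (AllPairs.map⁺ (AllPairs.tabulate⁺ rows-disjoint))
    where
    row-unique : ∀ i → Unique (row i)
    row-unique i = Unique.map⁺ (cong proj₂) (Unique.filter⁺ (T? ∘ ordered i) (Unique.allFin⁺ n))
    first : ∀ {i e} → e ∈ row i → proj₁ e ≡ i
    first {i} e∈row with ∈-map∘filter⁻ (i ,_) (T? ∘ ordered i) {xs = allFin n} e∈row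
    ... | _ , _ , refl , _ = refl
    rows-disjoint : ∀ {i j} → i ≢ j → Disjoint (row i) (row j)
    rows-disjoint i≢j (e∈rowᵢ , e∈rowⱼ) = i≢j (trans (sym (first e∈rowᵢ)) (first e∈rowⱼ))

  edge-injective : ∀ {f f′} → lo f ≡ lo f′ → hi f ≡ hi f′ → f ≡ f′
  edge-injective lo≡ hi≡ = lookup-injective edgeList-unique (cong₂ _,_ lo≡ hi≡)

module Incidence {n} (G : SimpleGraph n) where
  open import Data.Integer using (_+_; _-_; _*_)
  open IntegerSums
  open LinearMaps
  open Laplacians
  open EdgeList G

  E : ℕ
  E = numEdges G

  inc : Fin E → Fin n → ℤ
  inc f w = δ w (lo f) + δ w (hi f)

  B : (Fin E → ℤ) → Fin n → ℤ
  B = act (λ w f → inc f w)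

  Bᵀ : (Fin n → ℤ) → Fin E → ℤ
  Bᵀ z f = z (lo f) + z (hi f)

  B-linear : IsLinear B
  B-linear = act-linear (λ w f → inc f w)

  B-δ : ∀ f w → B (δ f) w ≡ inc f w
  B-δ f w = trans (sum-cong-≗ (λ f′ → ℤP.*-comm (inc f′ w) (δ f f′))) (sum-δ f (λ f′ → inc f′ w))

  B-adjoint : ∀ (c : Fin n → ℤ) x → sum (λ w → c w * B x w) ≡ sum (λ f → Bᵀ c f * x f)
  B-adjoint c x = begin
    sum (λ w → c w * sum (λ f → inc f w * x f))
      ≡⟨ sum-cong-≗ (λ w → *-distribˡ-sum (c w) (λ f → inc f w * x f)) ⟩
    sum (λ w → sum (λ f → c w * (inc f w * x f)))
      ≡⟨ ∑-comm (λ w f → c w * (inc f w * x f)) ⟩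
    sum (λ f → sum (λ w → c w * (inc f w * x f)))
      ≡⟨ sum-cong-≗ (λ f → trans (sum-cong-≗ (λ w → regroup (c w) (δ w (lo f)) (δ w (hi f)) (x f)))
                                 (sym (*-distribʳ-sum (x f) (λ w → δ w (lo f) * c w + δ w (hi f) * c w)))) ⟩
    sum (λ f → sum (λ w → δ w (lo f) * c w + δ w (hi f) * c w) * x f)
      ≡⟨ sum-cong-≗ (λ f → cong (_* x f) (trans (∑-distrib-+ (λ w → δ w (lo f) * c w) (λ w → δ w (hi f) * c w))
                                                 (cong₂ _+_ (sum-δ′ (lo f) c) (sum-δ′ (hi f) c)))) ⟩
    sum (λ f → Bᵀ c f * x f) ∎
    where
    open ≡-Reasoning
    regroup : ∀ c a b x → c * ((a + b) * x) ≡ (a * c + b * c) * x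
    regroup = solve-∀

  sum-incident : ∀ w (φ : Fin n → ℤ) →
    sum (λ f → δ w (lo f) * φ (hi f) + δ w (hi f) * φ (lo f)) ≡ neighbourSum (adj G) φ w
  sum-incident w φ = begin
    sum (λ f → δ w (lo f) * φ (hi f) + δ w (hi f) * φ (lo f))
      ≡⟨ sum-edges-sym (λ i j → δ w i * φ j) ⟩
    sum (λ i → sum (λ j → 𝟙 (adj G i j) * (δ w i * φ j)))
      ≡⟨ sum-cong-≗ (λ i → trans (sum-cong-≗ (λ j → x∙yz≈y∙xz (𝟙 (adj G i j)) (δ w i) (φ j)))
                                 (sym (*-distribˡ-sum (δ w i) (λ j → 𝟙 (adj G i j) * φ j)))) ⟩
    sum (λ i → δ w i * neighbourSum (adj G) φ i)
      ≡⟨ sum-δ w (neighbourSum (adj G) φ) ⟩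
    neighbourSum (adj G) φ w ∎
    where open ≡-Reasoning

  sum-inc : ∀ w → sum (λ f → inc f w) ≡ deg (adj G) w
  sum-inc w = begin
    sum (λ f → inc f w)
      ≡⟨ sum-cong-≗ (λ f → sym (cong₂ _+_ (ℤP.*-identityʳ (δ w (lo f))) (ℤP.*-identityʳ (δ w (hi f))))) ⟩
    sum (λ f → δ w (lo f) * 1ℤ + δ w (hi f) * 1ℤ)
      ≡⟨ sum-incident w (λ _ → 1ℤ) ⟩
    neighbourSum (adj G) (λ _ → 1ℤ) w
      ≡⟨ sum-cong-≗ (λ u → ℤP.*-identityʳ (𝟙 (adj G w u))) ⟩
    deg (adj G) w ∎
    where open ≡-Reasoning

  B-Bᵀ : ∀ z w → B (Bᵀ z) w ≡ deg (adj G) w * z w + neighbourSum (adj G) z w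
  B-Bᵀ z w = begin
    sum (λ f → inc f w * (z (lo f) + z (hi f)))
      ≡⟨ sum-cong-≗ split ⟩
    sum (λ f → inc f w * z w + (δ w (lo f) * z (hi f) + δ w (hi f) * z (lo f)))
      ≡⟨ ∑-distrib-+ (λ f → inc f w * z w) (λ f → δ w (lo f) * z (hi f) + δ w (hi f) * z (lo f)) ⟩
    sum (λ f → inc f w * z w) + sum (λ f → δ w (lo f) * z (hi f) + δ w (hi f) * z (lo f))
      ≡⟨ cong₂ _+_ (trans (sym (*-distribʳ-sum (z w) (λ f → inc f w))) (cong (_* z w) (sum-inc w)))
                   (sum-incident w z) ⟩
    deg (adj G) w * z w + neighbourSum (adj G) z w ∎
    where
    open ≡-Reasoning
    expand : ∀ a b x y → (a + b) * (x + y) ≡ (a * x + b * y) + (a * y + b * x)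
    expand = solve-∀
    collect : ∀ a b z c → a * z + b * z + c ≡ (a + b) * z + c
    collect = solve-∀
    split : ∀ f → inc f w * (z (lo f) + z (hi f))
                ≡ inc f w * z w + (δ w (lo f) * z (hi f) + δ w (hi f) * z (lo f))
    split f = begin
      inc f w * (z (lo f) + z (hi f))
        ≡⟨ expand (δ w (lo f)) (δ w (hi f)) (z (lo f)) (z (hi f)) ⟩
      δ w (lo f) * z (lo f) + δ w (hi f) * z (hi f) + (δ w (lo f) * z (hi f) + δ w (hi f) * z (lo f))
        ≡⟨ cong (_+ (δ w (lo f) * z (hi f) + δ w (hi f) * z (lo f)))
                (cong₂ _+_ (δ-subst w (lo f) z) (δ-subst w (hi f) z)) ⟩
      δ w (lo f) * z w + δ w (hi f) * z w + (δ w (lo f) * z (hi f) + δ w (hi f) * z (lo f))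
        ≡⟨ collect (δ w (lo f)) (δ w (hi f)) (z w) _ ⟩
      inc f w * z w + (δ w (lo f) * z (hi f) + δ w (hi f) * z (lo f)) ∎

  -- lineAdj only records whether f and f′ meet, so distinct edges must share at most one endpoint.
  shared-endpoints : ∀ f f′ → inc f′ (lo f) + inc f′ (hi f) ≡ 𝟙 (lineAdj G f f′) + + 2 * δ f f′
  shared-endpoints f f′ with f ≟ f′
  ... | yes refl = cong₂ _+_ (cong₂ _+_ (δ-refl (lo f)) (δ-≢ (lo≢hi f)))
                             (cong₂ _+_ (δ-≢ (lo≢hi f ∘ sym)) (δ-refl (hi f)))
  ... | no f≢f′ = trans (𝟙-∨-pairwise-exclusive (lo f == lo f′) (lo f == hi f′) (hi f == lo f′) (hi f == hi f′)
                                                 ab ac ad bc bd cd)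
                        (sym (ℤP.+-identityʳ _))
    where
    ab : Exclusive (lo f == lo f′) (lo f == hi f′)
    ab p q = lo≢hi f′ (trans (sym (toWitness p)) (toWitness q))
    ac : Exclusive (lo f == lo f′) (hi f == lo f′)
    ac p q = lo≢hi f (trans (toWitness p) (sym (toWitness q)))
    ad : Exclusive (lo f == lo f′) (hi f == hi f′)
    ad p q = f≢f′ (edge-injective (toWitness p) (toWitness q))
    bc : Exclusive (lo f == hi f′) (hi f == lo f′)
    bc p q = <-asym (subst (λ k → toℕ (lo f) ℕ.< toℕ k) (toWitness q) (lo<hi f))
                    (subst (λ k → toℕ (lo f′) ℕ.< toℕ k) (sym (toWitness p)) (lo<hi f′))
    bd : Exclusive (lo f == hi f′) (hi f == hi f′)
    bd p q = lo≢hi f (trans (toWitness p) (sym (toWitness q)))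
    cd : Exclusive (hi f == lo f′) (hi f == hi f′)
    cd p q = lo≢hi f′ (trans (sym (toWitness p)) (toWitness q))

  line-neighbourSum : ∀ y f →
    neighbourSum (lineAdj G) y f ≡ B y (lo f) + B y (hi f) - + 2 * y f
  line-neighbourSum y f = begin
    sum (λ f′ → 𝟙 (lineAdj G f f′) * y f′)
      ≡⟨ sum-cong-≗ incidence-form ⟩
    sum (λ f′ → (inc f′ (lo f) * y f′ + inc f′ (hi f) * y f′) - + 2 * (δ f f′ * y f′))
      ≡⟨ sum-sub (λ f′ → inc f′ (lo f) * y f′ + inc f′ (hi f) * y f′) (λ f′ → + 2 * (δ f f′ * y f′)) ⟩
    sum (λ f′ → inc f′ (lo f) * y f′ + inc f′ (hi f) * y f′) - sum (λ f′ → + 2 * (δ f f′ * y f′))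
      ≡⟨ cong₂ _-_ (∑-distrib-+ (λ f′ → inc f′ (lo f) * y f′) (λ f′ → inc f′ (hi f) * y f′))
                   (trans (sym (*-distribˡ-sum (+ 2) (λ f′ → δ f f′ * y f′))) (cong (+ 2 *_) (sum-δ f y))) ⟩
    B y (lo f) + B y (hi f) - + 2 * y f ∎
    where
    open ≡-Reasoning
    shift : ∀ l d y → l * y ≡ (l + + 2 * d) * y - + 2 * (d * y)
    shift = solve-∀
    distrib : ∀ a b d y → (a + b) * y - + 2 * (d * y) ≡ (a * y + b * y) - + 2 * (d * y)
    distrib = solve-∀
    incidence-form : ∀ f′ → 𝟙 (lineAdj G f f′) * y f′
                          ≡ (inc f′ (lo f) * y f′ + inc f′ (hi f) * y f′) - + 2 * (δ f f′ * y f′)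
    incidence-form f′ = begin
      𝟙 (lineAdj G f f′) * y f′
        ≡⟨ shift (𝟙 (lineAdj G f f′)) (δ f f′) (y f′) ⟩
      (𝟙 (lineAdj G f f′) + + 2 * δ f f′) * y f′ - + 2 * (δ f f′ * y f′)
        ≡⟨ cong (λ s → s * y f′ - + 2 * (δ f f′ * y f′)) (sym (shared-endpoints f f′)) ⟩
      (inc f′ (lo f) + inc f′ (hi f)) * y f′ - + 2 * (δ f f′ * y f′)
        ≡⟨ distrib (inc f′ (lo f)) (inc f′ (hi f)) (δ f f′) (y f′) ⟩
      (inc f′ (lo f) * y f′ + inc f′ (hi f) * y f′) - + 2 * (δ f f′ * y f′) ∎

  line-laplacian : ∀ y f →
    laplacian (lineAdj G) y f ≡ (deg (adj G) (lo f) + deg (adj G) (hi f)) * y f - Bᵀ (B y) f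
  line-laplacian y f = begin
    laplacian (lineAdj G) y f
      ≡⟨ laplacian-expand (lineAdj G) y f ⟩
    deg (lineAdj G) f * y f - neighbourSum (lineAdj G) y f
      ≡⟨ cong₂ (λ d s → d * y f - s) line-deg (line-neighbourSum y f) ⟩
    (deg (adj G) (lo f) + deg (adj G) (hi f) - + 2 * 1ℤ) * y f - (B y (lo f) + B y (hi f) - + 2 * y f)
      ≡⟨ cancel (deg (adj G) (lo f)) (deg (adj G) (hi f)) (y f) (B y (lo f)) (B y (hi f)) ⟩
    (deg (adj G) (lo f) + deg (adj G) (hi f)) * y f - Bᵀ (B y) f ∎
    where
    open ≡-Reasoning
    cancel : ∀ a b x c d → (a + b - + 2 * 1ℤ) * x - (c + d - + 2 * x) ≡ (a + b) * x - (c + d)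
    cancel = solve-∀
    B-one : ∀ w → B (λ _ → 1ℤ) w ≡ deg (adj G) w
    B-one w = trans (sum-cong-≗ (λ f′ → ℤP.*-identityʳ (inc f′ w))) (sum-inc w)
    line-deg : deg (lineAdj G) f ≡ deg (adj G) (lo f) + deg (adj G) (hi f) - + 2 * 1ℤ
    line-deg = begin
      deg (lineAdj G) f
        ≡⟨ sum-cong-≗ (λ f′ → sym (ℤP.*-identityʳ (𝟙 (lineAdj G f f′)))) ⟩
      neighbourSum (lineAdj G) (λ _ → 1ℤ) f
        ≡⟨ line-neighbourSum (λ _ → 1ℤ) f ⟩
      B (λ _ → 1ℤ) (lo f) + B (λ _ → 1ℤ) (hi f) - + 2 * 1ℤ
        ≡⟨ cong₂ (λ a b → a + b - + 2 * 1ℤ) (B-one (lo f)) (B-one (hi f)) ⟩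
      deg (adj G) (lo f) + deg (adj G) (hi f) - + 2 * 1ℤ ∎

  edge-between : ∀ {u v} → adj G u v ≡ true → ∃ λ f → ∀ w → inc f w ≡ δ w u + δ w v
  edge-between {u} {v} u~v with <-cmp (toℕ u) (toℕ v)
  ... | tri< u<v _ _ =
    let f , lo≡u , hi≡v = edge-exists (ordered-intro u<v u~v)
    in f , λ w → cong₂ (λ a b → δ w a + δ w b) lo≡u hi≡v
  ... | tri> _ _ v<u =
    let f , lo≡v , hi≡u = edge-exists (ordered-intro v<u (trans (SimpleGraph.sym G v u) u~v))
    in f , λ w → trans (cong₂ (λ a b → δ w a + δ w b) lo≡v hi≡u) (ℤP.+-comm (δ w v) (δ w u))
  ... | tri≈ _ u≡v _ with refl ← toℕ-injective u≡v with () ← trans (sym u~v) (irrefl G u)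

module Weighted where
  open import Data.Integer using (_+_; _-_; _*_)
  open IntegerSums
  open LinearMaps
  open Laplacians

  -- In the semiregular case Γ = gcd(d₁,d₂), ω v = deg v / Γ, and ω′ v is the value of ω across any edge at v.
  record BalancedWeighting {n} (G : SimpleGraph n) : Set where
    field
      ω ω′     : Fin n → ℤ
      s π Γ    : ℤ
      ω+ω′≡s   : ∀ v → ω v + ω′ v ≡ s
      ω*ω′≡π   : ∀ v → ω v * ω′ v ≡ π
      deg≡Γ*ω  : ∀ v → deg (adj G) v ≡ Γ * ω v
      ω-across : ∀ {u v} → adj G u v ≡ true → ω v ≡ ω′ u

  semiregular-weighting : ∀ {n} (G : SimpleGraph n) (a b γ : ℕ) →
                          Semiregular G (a ℕ.* γ) (b ℕ.* γ) → BalancedWeighting G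
  semiregular-weighting G a b γ (c , c-proper , deg-false , deg-true) = record
    { ω        = λ v → + weight (c v)
    ; ω′       = λ v → + weight (not (c v))
    ; s        = + (a ℕ.+ b)
    ; π        = + (a ℕ.* b)
    ; Γ        = + γ
    ; ω+ω′≡s   = λ v → weight-sum (c v)
    ; ω*ω′≡π   = λ v → weight-product (c v)
    ; deg≡Γ*ω  = deg≡Γ*ω
    ; ω-across = ω-across
    }
    where
    weight : Bool → ℕ
    weight true  = b
    weight false = a
    weight-sum : ∀ x → + weight x + + weight (not x) ≡ + (a ℕ.+ b)
    weight-sum true  = trans (sym (ℤP.pos-+ b a)) (cong +_ (ℕP.+-comm b a))
    weight-sum false = sym (ℤP.pos-+ a b)
    weight-product : ∀ x → + weight x * + weight (not x) ≡ + (a ℕ.* b)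
    weight-product true  = trans (sym (ℤP.pos-* b a)) (cong +_ (ℕP.*-comm b a))
    weight-product false = sym (ℤP.pos-* a b)
    deg≡Γ*ω : ∀ v → deg (adj G) v ≡ + γ * + weight (c v)
    deg≡Γ*ω v = begin
      deg (adj G) v            ≡⟨ sym (degree≡deg (adj G) v) ⟩
      + degree (adj G) v       ≡⟨ cong +_ (trans degree≡weight*γ (ℕP.*-comm (weight (c v)) γ)) ⟩
      + (γ ℕ.* weight (c v))   ≡⟨ ℤP.pos-* γ (weight (c v)) ⟩
      + γ * + weight (c v)     ∎
      where
      open ≡-Reasoning
      degree≡weight*γ : degree (adj G) v ≡ weight (c v) ℕ.* γ
      degree≡weight*γ with c v in cv
      ... | true  = deg-true v cv
      ... | false = deg-false v cv
    ω-across : ∀ {u v} → adj G u v ≡ true → + weight (c v) ≡ + weight (not (c u))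
    ω-across {u} {v} u~v with c u in cu | c v in cv
    ... | true  | false = refl
    ... | false | true  = refl
    ... | true  | true  = ⊥-elim (c-proper u v u~v (trans cu (sym cv)))
    ... | false | false = ⊥-elim (c-proper u v u~v (trans cu (sym cv)))

  module LineGraphMap {n} {G : SimpleGraph n} (W : BalancedWeighting G) where
    open EdgeList G
    open Incidence G
    open BalancedWeighting W

    ω′-across : ∀ {u v} → adj G u v ≡ true → ω′ v ≡ ω u
    ω′-across {u} {v} u~v = begin
      ω′ v                   ≡⟨ sym (add-sub (ω v) (ω′ v)) ⟩
      (ω v + ω′ v) - ω v     ≡⟨ cong₂ _-_ (trans (ω+ω′≡s v) (sym (ω+ω′≡s u))) (ω-across u~v) ⟩
      (ω u + ω′ u) - ω′ u    ≡⟨ add-sub′ (ω u) (ω′ u) ⟩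
      ω u                    ∎
      where
      open ≡-Reasoning
      add-sub : ∀ a b → (a + b) - a ≡ b
      add-sub = solve-∀
      add-sub′ : ∀ a b → (a + b) - b ≡ a
      add-sub′ = solve-∀

    Bᵀω≡s : ∀ f → Bᵀ ω f ≡ s
    Bᵀω≡s f = trans (cong (_+_ (ω (lo f))) (ω-across (edge-adj f))) (ω+ω′≡s (lo f))

    deg-edge : ∀ f → deg (adj G) (lo f) + deg (adj G) (hi f) ≡ Γ * s
    deg-edge f = begin
      deg (adj G) (lo f) + deg (adj G) (hi f)  ≡⟨ cong₂ _+_ (deg≡Γ*ω (lo f)) (deg≡Γ*ω (hi f)) ⟩
      Γ * ω (lo f) + Γ * ω (hi f)              ≡⟨ sym (ℤP.*-distribˡ-+ Γ (ω (lo f)) (ω (hi f))) ⟩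
      Γ * Bᵀ ω f                               ≡⟨ cong (Γ *_) (Bᵀω≡s f) ⟩
      Γ * s                                    ∎
      where open ≡-Reasoning

    g h : (Fin E → ℤ) → Fin n → ℤ
    g x v = ω v * B x v
    h y v = ω′ v * B y v

    g-sum-zero : ∀ x → sum x ≡ 0ℤ → sum (g x) ≡ 0ℤ
    g-sum-zero x Σx≡0 = begin
      sum (λ v → ω v * B x v)     ≡⟨ B-adjoint ω x ⟩
      sum (λ f → Bᵀ ω f * x f)    ≡⟨ sum-cong-≗ (λ f → cong (_* x f) (Bᵀω≡s f)) ⟩
      sum (λ f → s * x f)         ≡⟨ sym (*-distribˡ-sum s x) ⟩
      s * sum x                   ≡⟨ cong (s *_) Σx≡0 ⟩
      s * 0ℤ                      ≡⟨ ℤP.*-zeroʳ s ⟩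
      0ℤ                          ∎
      where open ≡-Reasoning

    B-line-laplacian : ∀ y v →
      B (laplacian (lineAdj G) y) v ≡ (Γ * s) * B y v - (deg (adj G) v * B y v + neighbourSum (adj G) (B y) v)
    B-line-laplacian y v = begin
      B (laplacian (lineAdj G) y) v
        ≡⟨ ≗-cong (λ f → trans (line-laplacian y f) (cong (λ d → d * y f - Bᵀ (B y) f) (deg-edge f))) v ⟩
      B (λ f → (Γ * s) * y f - Bᵀ (B y) f) v
        ≡⟨ sub-hom (λ f → (Γ * s) * y f) (Bᵀ (B y)) v ⟩
      B (λ f → (Γ * s) * y f) v - B (Bᵀ (B y)) v
        ≡⟨ cong₂ _-_ (*-hom (Γ * s) y v) (B-Bᵀ (B y) v) ⟩
      (Γ * s) * B y v - (deg (adj G) v * B y v + neighbourSum (adj G) (B y) v) ∎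
      where
      open ≡-Reasoning
      open IsLinear B-linear

    g-intertwines : ∀ y → g (laplacian (lineAdj G) y) ≗ laplacian (adj G) (h y)
    g-intertwines y v = begin
      ω v * B (laplacian (lineAdj G) y) v
        ≡⟨ cong (ω v *_) (B-line-laplacian y v) ⟩
      ω v * ((Γ * s) * b - (deg (adj G) v * b + N))
        ≡⟨ cong₂ (λ t d → ω v * ((Γ * t) * b - (d * b + N))) (sym (ω+ω′≡s v)) (deg≡Γ*ω v) ⟩
      ω v * ((Γ * (ω v + ω′ v)) * b - ((Γ * ω v) * b + N))
        ≡⟨ regroup (ω v) (ω′ v) Γ b N ⟩
      (Γ * ω v) * (ω′ v * b) - ω v * N
        ≡⟨ sym (cong₂ (λ d m → d * (ω′ v * b) - m)
                      (deg≡Γ*ω v) (neighbourSum-factor (adj G) ω′ (B y) (λ _ → ω′-across))) ⟩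
      deg (adj G) v * h y v - neighbourSum (adj G) (h y) v
        ≡⟨ sym (laplacian-expand (adj G) (h y) v) ⟩
      laplacian (adj G) (h y) v ∎
      where
      open ≡-Reasoning
      b N : ℤ
      b = B y v
      N = neighbourSum (adj G) (B y) v
      regroup : ∀ w w′ Γ b N → w * ((Γ * (w + w′)) * b - ((Γ * w) * b + N)) ≡ (Γ * w) * (w′ * b) - w * N
      regroup = solve-∀

    open Induced g (scale-linear ω B-linear) g-sum-zero h g-intertwines public

    lift : (Fin E → ℤ) → (Fin n → ℤ) → Fin E → ℤ
    lift x z = λ f → Bᵀ (λ v → ω v * z v) f + π * x f

    B-lift : ∀ x z → g x ≗ laplacian (adj G) z → ∀ v → B (lift x z) v ≡ (Γ * s) * (ω v * z v)
    B-lift x z gx≗Lz v = begin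
      B (lift x z) v
        ≡⟨ trans (+-hom (Bᵀ ωz) (λ f → π * x f) v) (cong₂ _+_ (B-Bᵀ ωz v) (*-hom π x v)) ⟩
      deg (adj G) v * (ω v * z v) + neighbourSum (adj G) ωz v + π * b
        ≡⟨ cong₂ (λ d m → d * (ω v * z v) + m + π * b)
                 (deg≡Γ*ω v) (neighbourSum-factor (adj G) ω z (λ _ → ω-across)) ⟩
      (Γ * ω v) * (ω v * z v) + ω′ v * N + π * b
        ≡⟨ cong (λ t → (Γ * ω v) * (ω v * z v) + ω′ v * N + t)
                (trans (cong (_* b) (sym (ω*ω′≡π v))) (xy∙z≈y∙xz (ω v) (ω′ v) b)) ⟩
      (Γ * ω v) * (ω v * z v) + ω′ v * N + ω′ v * (ω v * b)
        ≡⟨ cong (λ t → (Γ * ω v) * (ω v * z v) + ω′ v * N + ω′ v * t) gx≡ΓωzN ⟩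
      (Γ * ω v) * (ω v * z v) + ω′ v * N + ω′ v * ((Γ * ω v) * z v - N)
        ≡⟨ collect Γ (ω v) (ω′ v) (z v) N ⟩
      (Γ * (ω v + ω′ v)) * (ω v * z v)
        ≡⟨ cong (λ t → (Γ * t) * (ω v * z v)) (ω+ω′≡s v) ⟩
      (Γ * s) * (ω v * z v) ∎
      where
      open ≡-Reasoning
      open IsLinear B-linear
      ωz : Fin n → ℤ
      ωz u = ω u * z u
      b N : ℤ
      b = B x v
      N = neighbourSum (adj G) z v
      gx≡ΓωzN : ω v * b ≡ (Γ * ω v) * z v - N
      gx≡ΓωzN = trans (gx≗Lz v) (trans (laplacian-expand (adj G) z v) (cong (λ d → d * z v - N) (deg≡Γ*ω v)))
      collect : ∀ Γ w w′ z N → (Γ * w) * (w * z) + w′ * N + w′ * ((Γ * w) * z - N) ≡ (Γ * (w + w′)) * (w * z)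
      collect = solve-∀

    -- If g x = L z in K(G), then (Γ s π) x = L_line (Bᵀ(ω z) + π x).
    kernel-torsion : ∀ k → + k ≡ Γ * s * π → KerTorsion inducedHom k
    kernel-torsion k k≡Γsπ (x , _) (z , gx-0≡Lz) = lift x z , λ f → begin
      + k * x f - 0ℤ
        ≡⟨ trans (ℤP.+-identityʳ (+ k * x f)) (cong (_* x f) k≡Γsπ) ⟩
      (Γ * s * π) * x f
        ≡⟨ cancel (Γ * s) π (x f) (ω (lo f) * z (lo f)) (ω (hi f) * z (hi f)) ⟩
      (Γ * s) * lift x z f - ((Γ * s) * (ω (lo f) * z (lo f)) + (Γ * s) * (ω (hi f) * z (hi f)))
        ≡⟨ sym (cong₂ (λ d t → d * lift x z f - t)
                      (deg-edge f) (cong₂ _+_ (B-lift x z gx≗Lz (lo f)) (B-lift x z gx≗Lz (hi f)))) ⟩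
      (deg (adj G) (lo f) + deg (adj G) (hi f)) * lift x z f - Bᵀ (B (lift x z)) f
        ≡⟨ sym (line-laplacian (lift x z) f) ⟩
      laplacian (lineAdj G) (lift x z) f ∎
      where
      open ≡-Reasoning
      gx≗Lz : g x ≗ laplacian (adj G) z
      gx≗Lz v = trans (sym (ℤP.+-identityʳ (g x v))) (gx-0≡Lz v)
      cancel : ∀ D π x a b → (D * π) * x ≡ D * (a + b + π * x) - (D * a + D * b)
      cancel = solve-∀

    neighbour-difference-inImage : ∀ {u v v′} → adj G u v ≡ true → adj G u v′ ≡ true →
                                   InImage (λ i → ω′ u * (δ v′ i - δ v i))
    neighbour-difference-inImage {u} {v} {v′} u~v u~v′ with edge-between u~v | edge-between u~v′
    ... | f , inc-f | f′ , inc-f′ = x , Σx≡0 , (λ _ → 0ℤ) , λ i →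
      sym (trans (cong (_+_ (g x i)) (zero-hom i)) (trans (ℤP.+-identityʳ (g x i)) (gx≡ i)))
      where
      open ≡-Reasoning
      open IsLinear (laplacian-linear (adj G)) using (zero-hom)
      x : Fin E → ℤ
      x e = δ f′ e - δ f e
      Σx≡0 : sum x ≡ 0ℤ
      Σx≡0 = trans (sum-sub (δ f′) (δ f)) (cong₂ _-_ (sum-δ-one f′) (sum-δ-one f))
      Bx≡ : ∀ i → B x i ≡ δ i v′ - δ i v
      Bx≡ i = begin
        B x i
          ≡⟨ IsLinear.sub-hom B-linear (δ f′) (δ f) i ⟩
        B (δ f′) i - B (δ f) i
          ≡⟨ cong₂ _-_ (trans (B-δ f′ i) (inc-f′ i)) (trans (B-δ f i) (inc-f i)) ⟩
        (δ i u + δ i v′) - (δ i u + δ i v)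
          ≡⟨ cancel (δ i u) (δ i v′) (δ i v) ⟩
        δ i v′ - δ i v ∎
        where
        cancel : ∀ a b c → (a + b) - (a + c) ≡ b - c
        cancel = solve-∀
      gx≡ : ∀ i → g x i ≡ ω′ u * (δ v′ i - δ v i)
      gx≡ i = begin
        ω i * B x i
          ≡⟨ trans (cong (ω i *_) (Bx≡ i)) (distrib (ω i) (δ i v′) (δ i v)) ⟩
        δ i v′ * ω i - δ i v * ω i
          ≡⟨ sym (cong₂ _-_ (δ-subst i v′ ω) (δ-subst i v ω)) ⟩
        δ i v′ * ω v′ - δ i v * ω v
          ≡⟨ cong₂ (λ a b → δ i v′ * a - δ i v * b) (ω-across u~v′) (ω-across u~v) ⟩
        δ i v′ * ω′ u - δ i v * ω′ u
          ≡⟨ cong₂ (λ a b → a * ω′ u - b * ω′ u) (δ-sym i v′) (δ-sym i v) ⟩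
        δ v′ i * ω′ u - δ v i * ω′ u
          ≡⟨ sym (distrib (ω′ u) (δ v′ i) (δ v i)) ⟩
        ω′ u * (δ v′ i - δ v i) ∎
        where
        distrib : ∀ w a b → w * (a - b) ≡ a * w - b * w
        distrib = solve-∀

    -- (πΓ)(e_u - e_v) = L(ω′(u) e_u) + Σ_{v′ ~ u} ω′(u)(e_{v′} - e_v), since ω′(u) deg(u) = πΓ.
    edge-difference-inImage : ∀ u v → adj G u v ≡ true → InImage (λ i → (π * Γ) * (δ u i - δ v i))
    edge-difference-inImage u v u~v =
      ≗-closed combination (+-closed (laplacian-inImage (λ t → ω′ u * δ u t))
                                     (sum-closed term term-inImage))
      where
      open ≡-Reasoning
      open IsSubmodule inImage-submodule
      term : Fin n → Fin n → ℤ
      term v′ i = 𝟙 (adj G u v′) * (ω′ u * (δ v′ i - δ v i))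
      term-inImage : ∀ v′ → InImage (term v′)
      term-inImage v′ with adj G u v′ in u~v′
      ... | true  = ≗-closed (λ i → sym (ℤP.*-identityˡ _)) (neighbour-difference-inImage u~v u~v′)
      ... | false = zero-closed
      ω′deg≡πΓ : ω′ u * deg (adj G) u ≡ π * Γ
      ω′deg≡πΓ = trans (cong (ω′ u *_) (deg≡Γ*ω u)) (trans (rotate (ω′ u) Γ (ω u)) (cong (_* Γ) (ω*ω′≡π u)))
        where
        rotate : ∀ w′ Γ w → w′ * (Γ * w) ≡ (w * w′) * Γ
        rotate = solve-∀
      combination : (λ i → laplacian (adj G) (λ t → ω′ u * δ u t) i + sum (λ v′ → term v′ i))
                    ≗ (λ i → (π * Γ) * (δ u i - δ v i))
      combination i = begin
        laplacian (adj G) (λ t → ω′ u * δ u t) i + sum (λ v′ → term v′ i)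
          ≡⟨ cong₂ _+_ (trans (IsLinear.*-hom (laplacian-linear (adj G)) (ω′ u) (δ u) i)
                              (cong (ω′ u *_) (laplacian-δ (adj G) u i)))
                       (trans (sum-cong-≗ (λ v′ → x∙yz≈y∙xz (𝟙 (adj G u v′)) (ω′ u) (δ v′ i - δ v i)))
                              (trans (sym (*-distribˡ-sum (ω′ u) (λ v′ → 𝟙 (adj G u v′) * (δ v′ i - δ v i))))
                                     (cong (ω′ u *_) (sum-neighbour-differences (adj G) u v i)))) ⟩
        ω′ u * (δ u i * deg (adj G) u - 𝟙 (adj G i u)) + ω′ u * (𝟙 (adj G u i) - δ v i * deg (adj G) u)
          ≡⟨ cong (λ a → ω′ u * (δ u i * deg (adj G) u - 𝟙 a) + ω′ u * (𝟙 (adj G u i) - δ v i * deg (adj G) u))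
                  (SimpleGraph.sym G i u) ⟩
        ω′ u * (δ u i * deg (adj G) u - 𝟙 (adj G u i)) + ω′ u * (𝟙 (adj G u i) - δ v i * deg (adj G) u)
          ≡⟨ telescope (ω′ u) (deg (adj G) u) (δ u i) (δ v i) (𝟙 (adj G u i)) ⟩
        (ω′ u * deg (adj G) u) * (δ u i - δ v i)
          ≡⟨ cong (_* (δ u i - δ v i)) ω′deg≡πΓ ⟩
        (π * Γ) * (δ u i - δ v i) ∎
        where
        telescope : ∀ w d a b c → w * (a * d - c) + w * (c - b * d) ≡ (w * d) * (a - b)
        telescope = solve-∀

    cokernel-torsion : Connected G → ∀ k → + k ≡ π * Γ → CokerTorsion inducedHom k
    cokernel-torsion conn k k≡πΓ = inImage⇒cokerTorsion k λ y Σy≡0 →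
      subst (λ c → InImage (λ i → c * y i)) (sym k≡πΓ)
            (connected-spans-sum-zero G conn inImage-submodule (π * Γ) edge-difference-inImage y Σy≡0)

-- Opened only now: the modules above open the ℤ operators of the same names.
open import Data.Nat using (_+_; _*_)

lcm≡cofactors*gcd : ∀ {m n a b} .{{_ : NonZero (gcd m n)}} →
                   m ≡ a * gcd m n → n ≡ b * gcd m n → lcm m n ≡ a * b * gcd m n
lcm≡cofactors*gcd {m} {n} {a} {b} m≡aγ n≡bγ =
  ℕP.*-cancelˡ-≡ (lcm m n) (a * b * gcd m n) (gcd m n) (begin
    gcd m n * lcm m n                  ≡⟨ gcd*lcm m n ⟩
    m * n                              ≡⟨ cong₂ _*_ m≡aγ n≡bγ ⟩
    (a * gcd m n) * (b * gcd m n)      ≡⟨ rearrange a b (gcd m n) ⟩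
    gcd m n * (a * b * gcd m n)        ∎)
  where
  open ≡-Reasoning
  rearrange : ∀ a b γ → (a * γ) * (b * γ) ≡ γ * (a * b * γ)
  rearrange = ℕ-RingSolver.solve-∀

sum/gcd≡sum-of-cofactors : ∀ {m n a b} .{{_ : NonZero (gcd m n)}} →
                           m ≡ a * gcd m n → n ≡ b * gcd m n → (m + n) / gcd m n ≡ a + b
sum/gcd≡sum-of-cofactors {m} {n} {a} {b} m≡aγ n≡bγ =
  trans (cong (_/ gcd m n) (trans (cong₂ _+_ m≡aγ n≡bγ) (sym (ℕP.*-distribʳ-+ (gcd m n) a b))))
        (m*n/n≡m (a + b) (gcd m n))

theorem1p5 : ∀ {n} (G : SimpleGraph n) (d1 d2 : ℕ) .{{_ : NonZero (gcd d1 d2)}} →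
    Connected G → Semiregular G d1 d2 →
    Σ (KHom (lineAdj G) (adj G)) λ g →
      CokerTorsion g (lcm d1 d2)
      × KerTorsion g (((d1 + d2) / gcd d1 d2) * lcm d1 d2)
theorem1p5 G d1 d2 connected semiregular with gcd[m,n]∣m d1 d2 | gcd[m,n]∣n d1 d2
... | divides a d1≡aγ | divides b d2≡bγ =
  inducedHom ,
  cokernel-torsion connected (lcm d1 d2) (trans (cong +_ lcm≡abγ) (ℤP.pos-* (a * b) γ)) ,
  kernel-torsion _ (trans (cong +_ N≡γ[a+b]ab) (pos-*³ γ (a + b) (a * b)))
  where
  γ : ℕ
  γ = gcd d1 d2
  open Weighted.LineGraphMap
         (Weighted.semiregular-weighting G a b γ (subst₂ (Semiregular G) d1≡aγ d2≡bγ semiregular))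
  lcm≡abγ : lcm d1 d2 ≡ a * b * γ
  lcm≡abγ = lcm≡cofactors*gcd {a = a} {b} d1≡aγ d2≡bγ
  N≡γ[a+b]ab : ((d1 + d2) / γ) * lcm d1 d2 ≡ γ * (a + b) * (a * b)
  N≡γ[a+b]ab = trans (cong₂ _*_ (sum/gcd≡sum-of-cofactors {a = a} {b} d1≡aγ d2≡bγ) lcm≡abγ) (rearrange a b γ)
    where
    rearrange : ∀ a b γ → (a + b) * (a * b * γ) ≡ γ * (a + b) * (a * b)
    rearrange = ℕ-RingSolver.solve-∀
  pos-*³ : ∀ x y z → + (x * y * z) ≡ + x ℤ.* + y ℤ.* + z
  pos-*³ x y z = trans (ℤP.pos-* (x * y) z) (cong (ℤ._* + z) (ℤP.pos-* x y))
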